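{- Let $x_F$ be the Fibonacci word, the fixed point of $0\mapsto 01$, $1\mapsto 0$, let $\mathcal{L}_F$ be the set of nonempty finite factors of $x_F$, and let $S:\mathcal{L}_F\to\mathbb{N}$ be given by $S(w)=3|w|_0+|w|_1$ (so $S(0)=a=3$, $S(1)=b=1$). Let $C$ be the increasing enumeration of $\mathbb{N}\setminus S(\mathcal{L}_F)$ and $\Delta C=(C(n+1)-C(n))_{n\ge1}$. Let $x_H$ be the fixed point starting with $a$ of the morphism $h$ on $\{a,b\}$ given by $h(a)=aab$, $h(b)=ab$. Then $\Delta C=\delta(x_H)$, where $\delta:\{a,b\}\to\{7,11\}^*$ is the morphism $\delta(a)=7\,11$ (the two-letter word with letters $7$ and $11$), $\delta(b)=11$ (the one-letter word $11$).
   Context: $\mathbb{N}=\{1,2,3,\dots\}$. $|w|_0,|w|_1$ denote the numbers of occurrences of $0$ and $1$ in $w$; $S$ is the homomorphism of the Fibonacci language into $\mathbb{N}$ with $S(0)=3$, $S(1)=1$. $\Delta C$ is regarded as an infinite word over the alphabet of positive integers, and $\delta(x_H)$ is the concatenation of the images of the letters of $x_H$. -}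

module Defs where

open import Data.Nat using (ℕ; zero; suc; _+_; _*_)
open import Data.List using (List; []; _∷_; concatMap; map; upTo)
open import Data.Product using (Σ; ∃; _×_)
open import Relation.Binary.PropositionalEquality using (_≡_)

-- nth letter of a finite list, with a default (never used below, by length bounds)
nthD : {A : Set} → A → List A → ℕ → A
nthD d []       _       = d
nthD d (x ∷ xs) zero    = x
nthD d (x ∷ xs) (suc n) = nthD d xs n

iter : {A : Set} → ℕ → (A → A) → A → A
iter zero    f x = x
iter (suc k) f x = f (iter k f x)

data Bin : Set where
  𝟎 𝟏 : Bin

φ : Bin → List Bin
φ 𝟎 = 𝟎 ∷ 𝟏 ∷ []
φ 𝟏 = 𝟎 ∷ []

-- φ^k(0); it has length F_{k+2} ≥ k+1 and φ^k(0) is a prefix of φ^{k+1}(0)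
fibPrefix : ℕ → List Bin
fibPrefix k = iter k (concatMap φ) (𝟎 ∷ [])

xF : ℕ → Bin
xF n = nthD 𝟎 (fibPrefix (suc n)) n

factor : ℕ → ℕ → List Bin
factor i len = map (λ j → xF (i + j)) (upTo len)

S : List Bin → ℕ
S []       = 0
S (𝟎 ∷ w) = 3 + S w
S (𝟏 ∷ w) = 1 + S w

InImageS : ℕ → Set
InImageS m = Σ ℕ λ i → Σ ℕ λ len → S (factor i (suc len)) ≡ m

data AB : Set where
  a b : AB

h : AB → List AB
h a = a ∷ a ∷ b ∷ []
h b = a ∷ b ∷ []

-- h^k(a); length ≥ k+1, and h^k(a) is a prefix of h^{k+1}(a)
hPrefix : ℕ → List AB
hPrefix k = iter k (concatMap h) (a ∷ [])

δ : AB → List ℕ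
δ a = 7 ∷ 11 ∷ []
δ b = 11 ∷ []

-- δ(x_H) as an infinite word over ℕ (indexed from 0);
-- δ(h^(n+1)(a)) has length ≥ n+1 and is a prefix of δ(x_H)
δxH : ℕ → ℕ
δxH n = nthD 0 (concatMap δ (hPrefix (suc n))) n

-- Write β = (3 − √5)/2. The Fibonacci word is the mechanical word x n = ⌊(n + 2)β⌋ − ⌊(n + 1)β⌋;
-- we build it this way, certifying each floor by integer inequalities, and check x = φ(x) by showing
-- that φ maps the prefix of length m onto the prefix of length g m = m + |x[0..m)|₀.
-- With Q n = S(x[0..n)) = 3n − 2⌊(n + 1)β⌋, the balance of mechanical words gives
-- S(w) ∈ {Q(|w| − 1) + 1, Q(|w| − 1) + 3} for every factor w; both values occur because every prefix
-- of x is left special, and so do all Q(n + 1). Hence the positive integers missing from S(𝓛_F) are 2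
-- and the Q(n) + 2 with x(n − 1) x(n) = 00, i.e. n = g³ k + 3. Two consecutive such values differ
-- by ρ(x k) = S(φ³(x k)), with ρ(0) = 11 and ρ(1) = 7; and since θ(a) = 10, θ(b) = 0 conjugates h to φ²
-- (0·θ(h w) = φ²(θ w)·0), δ(x_H) = 7 ρ(x 0) ρ(x 1) ρ(x 2) ⋯.

module Submission where

open import Defs
open import Data.Nat using (ℕ; zero; suc; _+_; _*_; _∸_; _<_; _≤_; z≤n; s≤s; _≤?_; _<?_)
open import Data.Nat.Properties
open import Data.Nat.Divisibility using (_∣_; divides)
open import Data.Nat.Induction using (<-rec)
open import Algebra.Properties.CommutativeSemigroup +-commutativeSemigroup using () renaming (interchange to +-interchange)
open import Data.Nat.Primality using (prime?; euclidsLemma)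
open import Data.Nat.Tactic.RingSolver using (solve)
open import Data.List using (List; []; _∷_; _++_; [_]; concatMap; map; length; applyUpTo; upTo)
open import Data.List.Properties using (length-map; map-applyUpTo; ∷-injectiveʳ; concatMap-++; ++-identityʳ; ++-cancelˡ; applyUpTo-∷ʳ; map-upTo; map-cong; ++-assoc; length-++; length-applyUpTo)
open import Data.Product using (Σ; _×_; _,_; proj₁; proj₂)
open import Data.Sum using (_⊎_; inj₁; inj₂; [_,_]′)
open import Function using (id; _∘_)
open import Function.Bundles using (_⇔_; mk⇔)
open import Relation.Binary.PropositionalEquality hiding ([_])
open import Relation.Binary.Definitions using (tri<; tri≈; tri>)
open import Relation.Nullary using (¬_; yes; no; contradiction)
open import Relation.Nullary.Decidable using (from-yes)

private
  variable
    u v X X₁ X₂ Y Y₁ Y₂ : ℕ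

square-cancel-≤ : ∀ u v → u * u ≤ v * v → u ≤ v
square-cancel-≤ u v u²≤v² with u ≤? v
... | yes u≤v = u≤v
... | no u≰v = contradiction u²≤v² (<⇒≱ (*-mono-< (≰⇒> u≰v) (≰⇒> u≰v)))

square-cancel-< : ∀ u v → u * u < v * v → u < v
square-cancel-< u v u²<v² with u <? v
... | yes u<v = u<v
... | no u≮v = contradiction u²<v² (≤⇒≯ (*-mono-≤ (≮⇒≥ u≮v) (≮⇒≥ u≮v)))

m+k≡n⇒m≤n : ∀ {m n} k → m + k ≡ n → m ≤ n
m+k≡n⇒m≤n k refl = m≤m+n _ k

+≡+⇒≤ : ∀ U V → u + U ≡ v + V → V ≤ U → u ≤ v
+≡+⇒≤ {u} {v} U V eq V≤U = +-cancelʳ-≤ U u v (≤-trans (≤-reflexive eq) (+-monoʳ-≤ v V≤U))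

+≡+⇒< : ∀ U V → u + U ≡ v + V → V < U → u < v
+≡+⇒< {u} {v} U V eq V<U = +-cancelʳ-< U u v (≤-<-trans (≤-reflexive eq) (+-monoʳ-< v V<U))

5∣²⇒5∣ : ∀ c → 5 ∣ c * c → 5 ∣ c
5∣²⇒5∣ c 5∣c² = [ id , id ]′ (euclidsLemma c c (from-yes (prime? 5)) 5∣c²)

√5-irrational : ∀ c X → c * c ≡ 5 * (X * X) → X ≡ 0
√5-irrational = <-rec _ descent
  where
  descent : ∀ c → (∀ {c′} → c′ < c → ∀ X → c′ * c′ ≡ 5 * (X * X) → X ≡ 0) →
            ∀ X → c * c ≡ 5 * (X * X) → X ≡ 0
  descent _ _ zero _ = refl
  descent c smaller X@(suc _) c²≡5X² with 5∣²⇒5∣ c (divides (X * X) (trans c²≡5X² (*-comm 5 (X * X))))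
  ... | divides q c≡q5 = contradiction (smaller X<c q X²≡5q²) q≢0
    where
    X<c : X < c
    X<c = square-cancel-< X c (subst (X * X <_) (trans (*-comm (X * X) 5) (sym c²≡5X²)) (m<m*n (X * X) 5 (s≤s (s≤s z≤n))))
    X²≡5q² : X * X ≡ 5 * (q * q)
    X²≡5q² = *-cancelˡ-≡ _ _ 5 (begin
      5 * (X * X)        ≡⟨ sym c²≡5X² ⟩
      c * c              ≡⟨ cong (λ z → z * z) c≡q5 ⟩
      (q * 5) * (q * 5)  ≡⟨ solve (q ∷ []) ⟩
      5 * (5 * (q * q))  ∎)
      where open ≡-Reasoning
    q≢0 : q ≢ 0
    q≢0 q≡0 = 0≢1+n (trans (cong (λ z → z * z) (sym (trans c≡q5 (cong (_* 5) q≡0)))) c²≡5X²)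

applyUpTo-+ : ∀ {A : Set} (f : ℕ → A) m n → applyUpTo f (m + n) ≡ applyUpTo f m ++ applyUpTo (λ j → f (m + j)) n
applyUpTo-+ f zero    n = refl
applyUpTo-+ f (suc m) n = cong (f 0 ∷_) (applyUpTo-+ (f ∘ suc) m n)

nthD-applyUpTo : ∀ {A : Set} (d : A) (f : ℕ → A) {n i} → i < n → nthD d (applyUpTo f n) i ≡ f i
nthD-applyUpTo d f {suc n} {zero}  _         = refl
nthD-applyUpTo d f {suc n} {suc i} (s≤s i<n) = nthD-applyUpTo d (f ∘ suc) i<n

applyUpTo-cong : ∀ {A : Set} {f h : ℕ → A} n → (∀ {j} → j < n → f j ≡ h j) → applyUpTo f n ≡ applyUpTo h n
applyUpTo-cong zero    _   = refl
applyUpTo-cong (suc n) f≗h = cong₂ _∷_ (f≗h (s≤s z≤n)) (applyUpTo-cong n (f≗h ∘ s≤s))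

applyUpTo-injective : ∀ {A : Set} {f h : ℕ → A} {n j} → applyUpTo f n ≡ applyUpTo h n → j < n → f j ≡ h j
applyUpTo-injective {f = f} {h} {j = j} eq j<n =
  trans (sym (nthD-applyUpTo (f j) f j<n)) (trans (cong (λ w → nthD (f j) w j) eq) (nthD-applyUpTo (f j) h j<n))

iter-concatMap-++ : ∀ {A : Set} (f : A → List A) k u v →
                    iter k (concatMap f) (u ++ v) ≡ iter k (concatMap f) u ++ iter k (concatMap f) v
iter-concatMap-++ f zero    u v = refl
iter-concatMap-++ f (suc k) u v =
  trans (cong (concatMap f) (iter-concatMap-++ f k u v)) (concatMap-++ f (iter k (concatMap f) u) (iter k (concatMap f) v))

nthD-∷ʳ : ∀ {A : Set} (d : A) w ℓ → nthD d (w ++ [ ℓ ]) (length w) ≡ ℓ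
nthD-∷ʳ d []      ℓ = refl
nthD-∷ʳ d (_ ∷ w) ℓ = nthD-∷ʳ d w ℓ

nthD-++ˡ : ∀ {A : Set} (d : A) u v {i} → i < length u → nthD d (u ++ v) i ≡ nthD d u i
nthD-++ˡ d (_ ∷ u) v {zero}  _         = refl
nthD-++ˡ d (_ ∷ u) v {suc i} (s≤s i<u) = nthD-++ˡ d u v i<u

-- IsFloor X Y says Y = ⌊β X⌋, witnessed by c = 3X − 2Y ≥ √5 X and d = 3X − 2Y − 2 < √5 X.

data Below (X Y : ℕ) : Set where
  below : ∀ c → 2 * Y + c ≡ 3 * X → 5 * (X * X) ≤ c * c → Below X Y

data Above (X Y : ℕ) : Set where
  above : ∀ d → 2 * Y + 2 + d ≡ 3 * X → d * d < 5 * (X * X) → Above X Y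

IsFloor : ℕ → ℕ → Set
IsFloor X Y = Below X Y × Above X Y

below≤above : Below X u → Above X v → u ≤ v
below≤above {X} {u} {v} (below c 2u+c≡3X 5X²≤c²) (above d 2v+2+d≡3X d²<5X²) with u ≤? v
... | yes u≤v = u≤v
... | no u≰v = contradiction (≤-<-trans (*-mono-≤ c≤d c≤d) d²<5X²) (≤⇒≯ 5X²≤c²)
  where
  c≤d : c ≤ d
  c≤d = +≡+⇒≤ (2 * u) (2 * v + 2) (begin
    c + 2 * u           ≡⟨ +-comm c (2 * u) ⟩
    2 * u + c           ≡⟨ trans 2u+c≡3X (sym 2v+2+d≡3X) ⟩
    2 * v + 2 + d       ≡⟨ +-comm (2 * v + 2) d ⟩
    d + (2 * v + 2)     ∎)
    (≤-trans (≤-reflexive (trans (+-comm (2 * v) 2) (sym (*-suc 2 v)))) (*-monoʳ-≤ 2 (≰⇒> u≰v)))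
    where open ≡-Reasoning

isFloor-unique : IsFloor X u → IsFloor X v → u ≡ v
isFloor-unique (bu , au) (bv , av) = ≤-antisym (below≤above bu av) (below≤above bv au)

cross-below : ∀ X₁ X₂ u v → 5 * (X₁ * X₁) ≤ u * u → 5 * (X₂ * X₂) ≤ v * v → 5 * (X₁ * X₂) ≤ u * v
cross-below X₁ X₂ u v h₁ h₂ = square-cancel-≤ _ _ (begin
  (5 * (X₁ * X₂)) * (5 * (X₁ * X₂)) ≡⟨ solve (X₁ ∷ X₂ ∷ []) ⟩
  (5 * (X₁ * X₁)) * (5 * (X₂ * X₂)) ≤⟨ *-mono-≤ h₁ h₂ ⟩
  (u * u) * (v * v)                 ≡⟨ solve (u ∷ v ∷ []) ⟩
  (u * v) * (u * v)                 ∎)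
  where open ≤-Reasoning

cross-above : ∀ X₁ X₂ u v → u * u ≤ 5 * (X₁ * X₁) → v * v ≤ 5 * (X₂ * X₂) → u * v ≤ 5 * (X₁ * X₂)
cross-above X₁ X₂ u v h₁ h₂ = square-cancel-≤ _ _ (begin
  (u * v) * (u * v)                 ≡⟨ solve (u ∷ v ∷ []) ⟩
  (u * u) * (v * v)                 ≤⟨ *-mono-≤ h₁ h₂ ⟩
  (5 * (X₁ * X₁)) * (5 * (X₂ * X₂)) ≡⟨ solve (X₁ ∷ X₂ ∷ []) ⟩
  (5 * (X₁ * X₂)) * (5 * (X₁ * X₂)) ∎)
  where open ≤-Reasoning

below-+ : Below X₁ Y₁ → Below X₂ Y₂ → Below (X₁ + X₂) (Y₁ + Y₂)
below-+ {X₁} {Y₁} {X₂} {Y₂} (below c₁ e₁ l₁) (below c₂ e₂ l₂) = below (c₁ + c₂) eq ineq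
  where
  eq : 2 * (Y₁ + Y₂) + (c₁ + c₂) ≡ 3 * (X₁ + X₂)
  eq = begin
    2 * (Y₁ + Y₂) + (c₁ + c₂)     ≡⟨ solve (Y₁ ∷ Y₂ ∷ c₁ ∷ c₂ ∷ []) ⟩
    (2 * Y₁ + c₁) + (2 * Y₂ + c₂) ≡⟨ cong₂ _+_ e₁ e₂ ⟩
    3 * X₁ + 3 * X₂               ≡⟨ sym (*-distribˡ-+ 3 X₁ X₂) ⟩
    3 * (X₁ + X₂)                 ∎
    where open ≡-Reasoning
  ineq : 5 * ((X₁ + X₂) * (X₁ + X₂)) ≤ (c₁ + c₂) * (c₁ + c₂)
  ineq = begin
    5 * ((X₁ + X₂) * (X₁ + X₂))                            ≡⟨ solve (X₁ ∷ X₂ ∷ []) ⟩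
    5 * (X₁ * X₁) + 5 * (X₂ * X₂) + 2 * (5 * (X₁ * X₂))    ≤⟨ +-mono-≤ (+-mono-≤ l₁ l₂) (*-monoʳ-≤ 2 (cross-below X₁ X₂ c₁ c₂ l₁ l₂)) ⟩
    c₁ * c₁ + c₂ * c₂ + 2 * (c₁ * c₂)                      ≡⟨ solve (c₁ ∷ c₂ ∷ []) ⟩
    (c₁ + c₂) * (c₁ + c₂)                                  ∎
    where open ≤-Reasoning

above-+ : Above X₁ Y₁ → Above X₂ Y₂ → Above (X₁ + X₂) (suc (Y₁ + Y₂))
above-+ {X₁} {Y₁} {X₂} {Y₂} (above d₁ e₁ h₁) (above d₂ e₂ h₂) = above (d₁ + d₂) eq ineq
  where
  eq : 2 * suc (Y₁ + Y₂) + 2 + (d₁ + d₂) ≡ 3 * (X₁ + X₂)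
  eq = begin
    2 * suc (Y₁ + Y₂) + 2 + (d₁ + d₂)     ≡⟨ solve (Y₁ ∷ Y₂ ∷ d₁ ∷ d₂ ∷ []) ⟩
    (2 * Y₁ + 2 + d₁) + (2 * Y₂ + 2 + d₂) ≡⟨ cong₂ _+_ e₁ e₂ ⟩
    3 * X₁ + 3 * X₂                       ≡⟨ sym (*-distribˡ-+ 3 X₁ X₂) ⟩
    3 * (X₁ + X₂)                         ∎
    where open ≡-Reasoning
  ineq : (d₁ + d₂) * (d₁ + d₂) < 5 * ((X₁ + X₂) * (X₁ + X₂))
  ineq = begin-strict
    (d₁ + d₂) * (d₁ + d₂)                               ≡⟨ solve (d₁ ∷ d₂ ∷ []) ⟩
    d₁ * d₁ + d₂ * d₂ + 2 * (d₁ * d₂)                   <⟨ +-mono-<-≤ (+-mono-< h₁ h₂) (*-monoʳ-≤ 2 (cross-above X₁ X₂ d₁ d₂ (<⇒≤ h₁) (<⇒≤ h₂))) ⟩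
    5 * (X₁ * X₁) + 5 * (X₂ * X₂) + 2 * (5 * (X₁ * X₂)) ≡⟨ solve (X₁ ∷ X₂ ∷ []) ⟩
    5 * ((X₁ + X₂) * (X₁ + X₂))                         ∎
    where open ≤-Reasoning

isFloor-+ : IsFloor X₁ Y₁ → IsFloor X₂ Y₂ → IsFloor (X₁ + X₂) Y → Y ≡ Y₁ + Y₂ ⊎ Y ≡ suc (Y₁ + Y₂)
isFloor-+ (lo₁ , hi₁) (lo₂ , hi₂) (lo , hi) with m≤n⇒m<n∨m≡n (below≤above lo (above-+ hi₁ hi₂))
... | inj₁ Y<1+Y₁+Y₂ = inj₁ (≤-antisym (≤-pred Y<1+Y₁+Y₂) (below≤above (below-+ lo₁ lo₂) hi))
... | inj₂ Y≡1+Y₁+Y₂ = inj₂ Y≡1+Y₁+Y₂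

below-strict : ∀ X c → 0 < X → 5 * (X * X) ≤ c * c → 5 * (X * X) < c * c
below-strict X c 0<X 5X²≤c² with m≤n⇒m<n∨m≡n 5X²≤c²
... | inj₁ 5X²<c² = 5X²<c²
... | inj₂ 5X²≡c² = contradiction (√5-irrational c X (sym 5X²≡c²)) (≢-sym (<⇒≢ 0<X))

+3≡3*suc : ∀ {l r X} → r ≡ 3 * X → l ≡ r + 3 → l ≡ 3 * suc X
+3≡3*suc {X = X} r≡3X l≡r+3 = trans l≡r+3 (trans (cong (_+ 3) r≡3X) (trans (+-comm (3 * X) 3) (sym (*-suc 3 X))))

isFloor-suc : ∀ X {Y} → IsFloor X Y → IsFloor (suc X) Y ⊎ IsFloor (suc X) (suc Y)
isFloor-suc X {Y} (below c ec lc , above d ed hd) with 5 * (suc X * suc X) ≤? suc c * suc c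
... | yes lc′ = inj₂ (below (suc c) (+3≡3*suc ec (solve (Y ∷ c ∷ []))) lc′ , above (suc d) (+3≡3*suc ed (solve (Y ∷ d ∷ []))) hd′)
  where
  d≤3X : d ≤ 3 * X
  d≤3X = ≤-trans (m≤n+m d (2 * Y + 2)) (≤-reflexive ed)
  hd′ : suc d * suc d < 5 * (suc X * suc X)
  hd′ = begin-strict
    suc d * suc d                     ≡⟨ solve (d ∷ []) ⟩
    d * d + (2 * d + 1)               <⟨ +-mono-<-≤ hd (+-monoˡ-≤ 1 (*-monoʳ-≤ 2 d≤3X)) ⟩
    5 * (X * X) + (2 * (3 * X) + 1)   ≤⟨ m≤m+n _ (4 * X + 4) ⟩
    5 * (X * X) + (2 * (3 * X) + 1) + (4 * X + 4) ≡⟨ solve (X ∷ []) ⟩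
    5 * (suc X * suc X)               ∎
    where open ≤-Reasoning
... | no ¬lc′ = inj₁ (below (c + 3) (+3≡3*suc ec (solve (Y ∷ c ∷ []))) lc′ , above (suc c) (+3≡3*suc ec (solve (Y ∷ c ∷ []))) (≰⇒> ¬lc′))
  where
  2X≤c : 2 * X ≤ c
  2X≤c = square-cancel-≤ (2 * X) c (begin
    (2 * X) * (2 * X) ≡⟨ solve (X ∷ []) ⟩
    4 * (X * X)       ≤⟨ *-monoˡ-≤ (X * X) (n≤1+n 4) ⟩
    5 * (X * X)       ≤⟨ lc ⟩
    c * c             ∎)
    where open ≤-Reasoning
  lc′ : 5 * (suc X * suc X) ≤ (c + 3) * (c + 3)
  lc′ = begin
    5 * (suc X * suc X)               ≤⟨ m≤m+n _ (2 * X + 4) ⟩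
    5 * (suc X * suc X) + (2 * X + 4) ≡⟨ solve (X ∷ []) ⟩
    5 * (X * X) + (6 * (2 * X) + 9)   ≤⟨ +-mono-≤ lc (+-monoˡ-≤ 9 (*-monoʳ-≤ 6 2X≤c)) ⟩
    c * c + (6 * c + 9)               ≡⟨ solve (c ∷ []) ⟩
    (c + 3) * (c + 3)                 ∎
    where open ≤-Reasoning

ones : Bin → ℕ
ones 𝟎 = 0
ones 𝟏 = 1

zeros : Bin → ℕ
zeros 𝟎 = 1
zeros 𝟏 = 0

ones+zeros : ∀ c → ones c + zeros c ≡ 1
ones+zeros 𝟎 = refl
ones+zeros 𝟏 = refl

step-letter : ∀ {X Y} → IsFloor X Y ⊎ IsFloor X (suc Y) → Bin
step-letter (inj₁ _) = 𝟎
step-letter (inj₂ _) = 𝟏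

step-floor : ∀ {X Y} → IsFloor X Y ⊎ IsFloor X (suc Y) → Σ ℕ (IsFloor X)
step-floor (inj₁ fl) = _ , fl
step-floor (inj₂ fl) = _ , fl

step-floor-value : ∀ {X Y} (s : IsFloor X Y ⊎ IsFloor X (suc Y)) → proj₁ (step-floor s) ≡ Y + ones (step-letter s)
step-floor-value {Y = Y} (inj₁ _) = sym (+-identityʳ Y)
step-floor-value {Y = Y} (inj₂ _) = +-comm 1 Y

isFloor-1-0 : IsFloor 1 0
isFloor-1-0 = below 3 refl (from-yes (5 ≤? 9)) , above 1 refl (from-yes (1 <? 5))

-- x n = ⌊(n + 2)β⌋ − ⌊(n + 1)β⌋ and p n = ⌊(n + 1)β⌋.

abstract
  floorβ : (n : ℕ) → Σ ℕ (IsFloor (suc n))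
  floorβ zero    = 0 , isFloor-1-0
  floorβ (suc n) = step-floor (isFloor-suc (suc n) (proj₂ (floorβ n)))

  x : ℕ → Bin
  x n = step-letter (isFloor-suc (suc n) (proj₂ (floorβ n)))

  p : ℕ → ℕ
  p n = proj₁ (floorβ n)

  isFloor-p : ∀ n → IsFloor (suc n) (p n)
  isFloor-p n = proj₂ (floorβ n)

  p-suc : ∀ n → p (suc n) ≡ p n + ones (x n)
  p-suc n = step-floor-value (isFloor-suc (suc n) (proj₂ (floorβ n)))

  p-0 : p 0 ≡ 0
  p-0 = refl

  x-0 : x 0 ≡ 𝟎
  x-0 = refl

  x-1 : x 1 ≡ 𝟏
  x-1 = refl

  x-2 : x 2 ≡ 𝟎
  x-2 = refl

  x-3 : x 3 ≡ 𝟎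
  x-3 = refl

-- The mechanical word is the Fibonacci word

q : ℕ → ℕ
q zero    = 0
q (suc n) = q n + zeros (x n)

p+q≡n : ∀ n → p n + q n ≡ n
p+q≡n zero    = trans (+-identityʳ (p 0)) p-0
p+q≡n (suc n) = begin
  p (suc n) + q (suc n)                    ≡⟨ cong (_+ q (suc n)) (p-suc n) ⟩
  (p n + ones (x n)) + (q n + zeros (x n)) ≡⟨ +-interchange (p n) (ones (x n)) (q n) (zeros (x n)) ⟩
  (p n + q n) + (ones (x n) + zeros (x n)) ≡⟨ cong₂ _+_ (p+q≡n n) (ones+zeros (x n)) ⟩
  n + 1                                    ≡⟨ +-comm n 1 ⟩
  suc n                                    ∎
  where open ≡-Reasoning

-- g m = |φ(x[0..m))| is where the image of the letter x m begins.
g : ℕ → ℕ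
g m = m + q m

p-of-isFloor : ∀ {n Y} → IsFloor (suc n) Y → p n ≡ Y
p-of-isFloor {n} = isFloor-unique (isFloor-p n)

isFloor-p+q : ∀ m → IsFloor (suc (p m + q m)) (p m)
isFloor-p+q m = subst (λ n → IsFloor (suc n) (p m)) (sym (p+q≡n m)) (isFloor-p m)

p-at : ∀ m k {Y} → IsFloor (suc k + (p m + q m + q m)) Y → p (k + g m) ≡ Y
p-at m k {Y} fl = p-of-isFloor (subst (λ n → IsFloor (suc k + (n + q m)) Y) (p+q≡n m) fl)

-- With t = p m and s = q m, the certificates at g m, g m + 1 and g m + 2 come from those at m
-- through identities c′² + d² = 5X′² + 5X², i.e. c′² − 5X′² = 5X² − d², which transfer the inequalities.

isFloor-at-g : ∀ {t s} → IsFloor (suc (t + s)) t → IsFloor (suc (t + s + s)) s × IsFloor (2 + (t + s + s)) s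
isFloor-at-g {t} {s} (below c ec lc , above d ed hd)
  with +-cancelˡ-≡ (2 * t) c (t + 3 * s + 3) (trans ec (solve (t ∷ s ∷ [])))
     | +-cancelˡ-≡ (2 * t + 2) d (t + 3 * s + 1) (trans ed (solve (t ∷ s ∷ [])))
... | refl | refl =
    ( below (3 * t + 4 * s + 3) (solve (t ∷ s ∷ [])) (+≡+⇒≤ _ _ norm₁ (<⇒≤ hd))
    , above (3 * t + 4 * s + 1) (solve (t ∷ s ∷ [])) (+≡+⇒< _ _ norm₂ 5[t+s]²<[t+3s+2]²) )
  , ( below (3 * t + 4 * s + 6) (solve (t ∷ s ∷ [])) (+≡+⇒≤ _ _ norm₃ (+-mono-≤ (<⇒≤ hd) 2d≤10X+4))
    , above (3 * t + 4 * s + 4) (solve (t ∷ s ∷ [])) (+≡+⇒< _ _ norm₄ 5X²<c²) )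
  where
  norm₁ : 5 * (suc (t + s + s) * suc (t + s + s)) + 5 * (suc (t + s) * suc (t + s))
        ≡ (3 * t + 4 * s + 3) * (3 * t + 4 * s + 3) + (t + 3 * s + 1) * (t + 3 * s + 1)
  norm₁ = solve (t ∷ s ∷ [])
  norm₂ : (3 * t + 4 * s + 1) * (3 * t + 4 * s + 1) + (t + 3 * s + 2) * (t + 3 * s + 2)
        ≡ 5 * (suc (t + s + s) * suc (t + s + s)) + 5 * ((t + s) * (t + s))
  norm₂ = solve (t ∷ s ∷ [])
  norm₃ : 5 * ((2 + (t + s + s)) * (2 + (t + s + s))) + (5 * (suc (t + s) * suc (t + s)) + (10 * suc (t + s) + 4))
        ≡ (3 * t + 4 * s + 6) * (3 * t + 4 * s + 6) + ((t + 3 * s + 1) * (t + 3 * s + 1) + 2 * (t + 3 * s + 1))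
  norm₃ = solve (t ∷ s ∷ [])
  norm₄ : (3 * t + 4 * s + 4) * (3 * t + 4 * s + 4) + (t + 3 * s + 3) * (t + 3 * s + 3)
        ≡ 5 * ((2 + (t + s + s)) * (2 + (t + s + s))) + 5 * (suc (t + s) * suc (t + s))
  norm₄ = solve (t ∷ s ∷ [])
  2d≤10X+4 : 2 * (t + 3 * s + 1) ≤ 10 * suc (t + s) + 4
  2d≤10X+4 = m+k≡n⇒m≤n (8 * t + 4 * s + 12) (solve (t ∷ s ∷ []))
  5X²<c² : 5 * (suc (t + s) * suc (t + s)) < (t + 3 * s + 3) * (t + 3 * s + 3)
  5X²<c² = below-strict (suc (t + s)) (t + 3 * s + 3) (s≤s z≤n) lc
  5[t+s]²<[t+3s+2]² : 5 * ((t + s) * (t + s)) < (t + 3 * s + 2) * (t + 3 * s + 2)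
  5[t+s]²<[t+3s+2]² = +-cancelʳ-< (10 * t + 10 * s + 5) _ _ (begin-strict
    5 * ((t + s) * (t + s)) + (10 * t + 10 * s + 5)   ≡⟨ solve (t ∷ s ∷ []) ⟩
    5 * (suc (t + s) * suc (t + s))                   <⟨ 5X²<c² ⟩
    (t + 3 * s + 3) * (t + 3 * s + 3)                 ≡⟨ solve (t ∷ s ∷ []) ⟩
    (t + 3 * s + 2) * (t + 3 * s + 2) + (2 * t + 6 * s + 5)  ≤⟨ +-monoʳ-≤ ((t + 3 * s + 2) * (t + 3 * s + 2)) (m≤m+n (2 * t + 6 * s + 5) (8 * t + 4 * s)) ⟩
    (t + 3 * s + 2) * (t + 3 * s + 2) + ((2 * t + 6 * s + 5) + (8 * t + 4 * s))  ≡⟨ solve (t ∷ s ∷ []) ⟩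
    (t + 3 * s + 2) * (t + 3 * s + 2) + (10 * t + 10 * s + 5) ∎)
    where open ≤-Reasoning

isFloor-at-2+g : ∀ {t s} → IsFloor (suc (t + s)) t → IsFloor (2 + (t + s)) t → IsFloor (3 + (t + s + s)) (suc s)
isFloor-at-2+g {t} {s} (below c ec lc , _) (_ , above d ed hd)
  with +-cancelˡ-≡ (2 * t) c (t + 3 * s + 3) (trans ec (solve (t ∷ s ∷ [])))
     | +-cancelˡ-≡ (2 * t + 2) d (t + 3 * s + 4) (trans ed (solve (t ∷ s ∷ [])))
... | refl | refl =
    below (3 * t + 4 * s + 7) (solve (t ∷ s ∷ [])) (+≡+⇒≤ _ _ norm₁ (<⇒≤ hd))
  , above (3 * t + 4 * s + 5) (solve (t ∷ s ∷ [])) (+≡+⇒< _ _ norm₂ (≤-<-trans lc (*-mono-< c<c+2 c<c+2)))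
  where
  norm₁ : 5 * ((3 + (t + s + s)) * (3 + (t + s + s))) + 5 * ((2 + (t + s)) * (2 + (t + s)))
        ≡ (3 * t + 4 * s + 7) * (3 * t + 4 * s + 7) + (t + 3 * s + 4) * (t + 3 * s + 4)
  norm₁ = solve (t ∷ s ∷ [])
  norm₂ : (3 * t + 4 * s + 5) * (3 * t + 4 * s + 5) + (t + 3 * s + 5) * (t + 3 * s + 5)
        ≡ 5 * ((3 + (t + s + s)) * (3 + (t + s + s))) + 5 * (suc (t + s) * suc (t + s))
  norm₂ = solve (t ∷ s ∷ [])
  c<c+2 : t + 3 * s + 3 < t + 3 * s + 5
  c<c+2 = +-monoʳ-< (t + 3 * s) (s≤s (s≤s (s≤s (s≤s z≤n))))

p-g : ∀ m → p (g m) ≡ q m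
p-g m = p-at m 0 (proj₁ (isFloor-at-g (isFloor-p+q m)))

p-suc-g : ∀ m → p (suc (g m)) ≡ q m
p-suc-g m = p-at m 1 (proj₂ (isFloor-at-g (isFloor-p+q m)))

p-suc-suc-g : ∀ m → x m ≡ 𝟎 → p (2 + g m) ≡ suc (q m)
p-suc-suc-g m x≡𝟎 = p-at m 2 (isFloor-at-2+g (isFloor-p+q m) isFloor-2+m)
  where
  isFloor-2+m : IsFloor (2 + (p m + q m)) (p m)
  isFloor-2+m = subst₂ IsFloor (cong (2 +_) (sym (p+q≡n m)))
                  (trans (p-suc m) (trans (cong (λ c → p m + ones c) x≡𝟎) (+-identityʳ (p m))))
                  (isFloor-p (suc m))

ones-x-by-p : ∀ {n Y k} → p n ≡ Y → p (suc n) ≡ Y + k → ones (x n) ≡ k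
ones-x-by-p {n} {Y} pn≡Y psn≡Y+k = +-cancelˡ-≡ Y _ _ (trans (cong (_+ ones (x n)) (sym pn≡Y)) (trans (sym (p-suc n)) psn≡Y+k))

ones≡0⇒≡𝟎 : ∀ {c} → ones c ≡ 0 → c ≡ 𝟎
ones≡0⇒≡𝟎 {𝟎} _ = refl

ones≡1⇒≡𝟏 : ∀ {c} → ones c ≡ 1 → c ≡ 𝟏
ones≡1⇒≡𝟏 {𝟏} _ = refl

x-g : ∀ m → x (g m) ≡ 𝟎
x-g m = ones≡0⇒≡𝟎 (ones-x-by-p (p-g m) (trans (p-suc-g m) (sym (+-identityʳ (q m)))))

x-suc-g : ∀ m → x m ≡ 𝟎 → x (suc (g m)) ≡ 𝟏
x-suc-g m x≡𝟎 = ones≡1⇒≡𝟏 (ones-x-by-p (p-suc-g m) (trans (p-suc-suc-g m x≡𝟎) (+-comm 1 (q m))))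

Φ : List Bin → List Bin
Φ = concatMap φ

pre : ℕ → List Bin
pre = applyUpTo x

length-φ : ∀ c → length (φ c) ≡ suc (zeros c)
length-φ 𝟎 = refl
length-φ 𝟏 = refl

g-suc : ∀ m → g (suc m) ≡ g m + length (φ (x m))
g-suc m = begin
  suc m + (q m + zeros (x m))   ≡⟨ cong suc (sym (+-assoc m (q m) (zeros (x m)))) ⟩
  suc (g m + zeros (x m))       ≡⟨ sym (+-suc (g m) (zeros (x m))) ⟩
  g m + suc (zeros (x m))       ≡⟨ cong (g m +_) (sym (length-φ (x m))) ⟩
  g m + length (φ (x m))        ∎
  where open ≡-Reasoning

g-suc-𝟎 : ∀ {m} → x m ≡ 𝟎 → g (suc m) ≡ 2 + g m
g-suc-𝟎 {m} x≡𝟎 = trans (g-suc m) (trans (cong (λ c → g m + length (φ c)) x≡𝟎) (+-comm (g m) 2))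

g-suc-𝟏 : ∀ {m} → x m ≡ 𝟏 → g (suc m) ≡ suc (g m)
g-suc-𝟏 {m} x≡𝟏 = trans (g-suc m) (trans (cong (λ c → g m + length (φ c)) x≡𝟏) (+-comm (g m) 1))

φ-at-g : ∀ m → applyUpTo (λ j → x (g m + j)) (length (φ (x m))) ≡ φ (x m)
φ-at-g m with x m in x≡
... | 𝟎 = cong₂ (λ u v → u ∷ v ∷ []) (trans (cong x (+-identityʳ (g m))) (x-g m))
                                      (trans (cong x (+-comm (g m) 1)) (x-suc-g m x≡))
... | 𝟏 = cong [_] (trans (cong x (+-identityʳ (g m))) (x-g m))

Φ-pre : ∀ m → Φ (pre m) ≡ pre (g m)
Φ-pre zero    = refl
Φ-pre (suc m) = begin
  Φ (pre (suc m))                 ≡⟨ cong Φ (sym (applyUpTo-∷ʳ x m)) ⟩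
  Φ (pre m ++ [ x m ])            ≡⟨ concatMap-++ φ (pre m) [ x m ] ⟩
  Φ (pre m) ++ (φ (x m) ++ [])    ≡⟨ cong₂ _++_ (Φ-pre m) (++-identityʳ (φ (x m))) ⟩
  pre (g m) ++ φ (x m)            ≡⟨ cong (pre (g m) ++_) (sym (φ-at-g m)) ⟩
  pre (g m) ++ applyUpTo (λ j → x (g m + j)) (length (φ (x m))) ≡⟨ sym (applyUpTo-+ x (g m) _) ⟩
  pre (g m + length (φ (x m)))    ≡⟨ cong pre (sym (g-suc m)) ⟩
  pre (g (suc m))                 ∎
  where open ≡-Reasoning

Φ^k-pre : ∀ k m → iter k Φ (pre m) ≡ pre (iter k g m)
Φ^k-pre zero    m = refl
Φ^k-pre (suc k) m = trans (cong Φ (Φ^k-pre k m)) (Φ-pre (iter k g m))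

fibPrefix≡pre : ∀ k → fibPrefix k ≡ pre (iter k g 1)
fibPrefix≡pre k = trans (cong (λ c → iter k Φ [ c ]) (sym x-0)) (Φ^k-pre k 1)

q-positive : ∀ m → 1 ≤ q (suc m)
q-positive zero    = subst (λ c → 1 ≤ zeros c) (sym x-0) ≤-refl
q-positive (suc m) = ≤-trans (q-positive m) (m≤m+n _ _)

g-grows : ∀ m → suc (suc m) ≤ g (suc m)
g-grows m = subst (_≤ g (suc m)) (+-comm (suc m) 1) (+-monoʳ-≤ (suc m) (q-positive m))

m≤g : ∀ m → m ≤ g m
m≤g m = m≤m+n m (q m)

iter-g-grows : ∀ k → suc k ≤ iter k g 1
iter-g-grows zero    = ≤-refl
iter-g-grows (suc k) with iter k g 1 | iter-g-grows k
... | suc n | k<n = ≤-trans (s≤s k<n) (g-grows n)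

xF≡x : ∀ n → xF n ≡ x n
xF≡x n = trans (cong (λ w → nthD 𝟎 w n) (fibPrefix≡pre (suc n)))
               (nthD-applyUpTo 𝟎 x (≤-trans (n≤1+n (suc n)) (iter-g-grows (suc n))))

-- Values of S on factors

S-++ : ∀ u v → S (u ++ v) ≡ S u + S v
S-++ []      v = refl
S-++ (𝟎 ∷ u) v = cong (3 +_) (S-++ u v)
S-++ (𝟏 ∷ u) v = cong suc (S-++ u v)

Q : ℕ → ℕ
Q n = S (pre n)

Q-suc : ∀ n → Q (suc n) ≡ Q n + S [ x n ]
Q-suc n = trans (cong S (sym (applyUpTo-∷ʳ x n))) (S-++ (pre n) [ x n ])

S-letter+2ones : ∀ c → S [ c ] + 2 * ones c ≡ 3
S-letter+2ones 𝟎 = refl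
S-letter+2ones 𝟏 = refl

Q+2p≡3n : ∀ n → Q n + 2 * p n ≡ 3 * n
Q+2p≡3n zero    = cong (2 *_) p-0
Q+2p≡3n (suc n) = begin
  Q (suc n) + 2 * p (suc n)                          ≡⟨ cong₂ (λ y z → y + 2 * z) (Q-suc n) (p-suc n) ⟩
  (Q n + S [ x n ]) + 2 * (p n + ones (x n))         ≡⟨ regroup (Q n) (S [ x n ]) (p n) (ones (x n)) ⟩
  (Q n + 2 * p n) + (S [ x n ] + 2 * ones (x n))     ≡⟨ cong₂ _+_ (Q+2p≡3n n) (S-letter+2ones (x n)) ⟩
  3 * n + 3                                          ≡⟨ solve (n ∷ []) ⟩
  3 * suc n                                          ∎
  where
  open ≡-Reasoning
  regroup : ∀ n₁ n₂ n₃ n₄ → (n₁ + n₂) + 2 * (n₃ + n₄) ≡ (n₁ + 2 * n₃) + (n₂ + 2 * n₄)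
  regroup n₁ n₂ n₃ n₄ = solve (n₁ ∷ n₂ ∷ n₃ ∷ n₄ ∷ [])

factor≡ : ∀ i len → factor i len ≡ applyUpTo (λ j → x (i + j)) len
factor≡ i len = trans (map-cong (λ j → xF≡x (i + j)) (upTo len)) (map-upTo (λ j → x (i + j)) len)

S-factor+Q : ∀ i len → S (factor i len) + Q i ≡ Q (i + len)
S-factor+Q i len = begin
  S (factor i len) + Q i                           ≡⟨ +-comm (S (factor i len)) (Q i) ⟩
  Q i + S (factor i len)                           ≡⟨ cong (λ w → Q i + S w) (factor≡ i len) ⟩
  Q i + S (applyUpTo (λ j → x (i + j)) len)        ≡⟨ sym (S-++ (pre i) _) ⟩
  S (pre i ++ applyUpTo (λ j → x (i + j)) len)     ≡⟨ cong S (sym (applyUpTo-+ x i len)) ⟩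
  Q (i + len)                                      ∎
  where open ≡-Reasoning

S-factor-via-p : ∀ i L ε → p (i + suc L) ≡ p i + p L + ε → S (factor i (suc L)) + 2 * ε ≡ Q L + 3
S-factor-via-p i L ε p≡ = +-cancelˡ-≡ (Q i + 2 * p i + 2 * p L) _ _ (begin
  (Q i + 2 * p i + 2 * p L) + (F + 2 * ε)          ≡⟨ regroup₁ F (Q i) (p i) (p L) ε ⟩
  (F + Q i) + 2 * (p i + p L + ε)                  ≡⟨ cong₂ (λ y z → y + 2 * z) (S-factor+Q i (suc L)) (sym p≡) ⟩
  Q (i + suc L) + 2 * p (i + suc L)                ≡⟨ Q+2p≡3n (i + suc L) ⟩
  3 * (i + suc L)                                  ≡⟨ solve (i ∷ L ∷ []) ⟩
  3 * i + 3 * L + 3                                ≡⟨ cong₂ (λ y z → y + z + 3) (Q+2p≡3n i) (Q+2p≡3n L) ⟨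
  (Q i + 2 * p i) + (Q L + 2 * p L) + 3            ≡⟨ regroup₂ (Q i) (p i) (Q L) (p L) ⟩
  (Q i + 2 * p i + 2 * p L) + (Q L + 3)            ∎)
  where
  open ≡-Reasoning
  F = S (factor i (suc L))
  regroup₁ : ∀ n₁ n₂ n₃ n₄ n₅ → (n₂ + 2 * n₃ + 2 * n₄) + (n₁ + 2 * n₅) ≡ (n₁ + n₂) + 2 * (n₃ + n₄ + n₅)
  regroup₁ n₁ n₂ n₃ n₄ n₅ = solve (n₁ ∷ n₂ ∷ n₃ ∷ n₄ ∷ n₅ ∷ [])
  regroup₂ : ∀ n₁ n₂ n₃ n₄ → (n₁ + 2 * n₂) + (n₃ + 2 * n₄) + 3 ≡ (n₁ + 2 * n₂ + 2 * n₄) + (n₃ + 3)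
  regroup₂ n₁ n₂ n₃ n₄ = solve (n₁ ∷ n₂ ∷ n₃ ∷ n₄ ∷ [])

S-factor-values : ∀ i L → S (factor i (suc L)) ≡ Q L + 1 ⊎ S (factor i (suc L)) ≡ Q L + 3
S-factor-values i L with isFloor-+ (isFloor-p i) (isFloor-p L) (isFloor-p (i + suc L))
... | inj₁ p≡ = inj₂ (trans (sym (+-identityʳ _)) (S-factor-via-p i L 0 (trans p≡ (sym (+-identityʳ _)))))
... | inj₂ p≡ = inj₁ (+-cancelʳ-≡ 2 _ _ (trans (S-factor-via-p i L 1 (trans p≡ (+-comm 1 _))) (sym (+-assoc (Q L) 1 2))))

pre-iter-g-suc : ∀ k m → pre (iter k g (suc m)) ≡ pre (iter k g m) ++ iter k Φ [ x m ]
pre-iter-g-suc k m = begin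
  pre (iter k g (suc m))                ≡⟨ Φ^k-pre k (suc m) ⟨
  iter k Φ (pre (suc m))                ≡⟨ cong (iter k Φ) (applyUpTo-∷ʳ x m) ⟨
  iter k Φ (pre m ++ [ x m ])           ≡⟨ iter-concatMap-++ φ k (pre m) [ x m ] ⟩
  iter k Φ (pre m) ++ iter k Φ [ x m ]  ≡⟨ cong (_++ iter k Φ [ x m ]) (Φ^k-pre k m) ⟩
  pre (iter k g m) ++ iter k Φ [ x m ]  ∎
  where open ≡-Reasoning

iter-g-suc : ∀ k m → iter k g (suc m) ≡ iter k g m + length (iter k Φ [ x m ])
iter-g-suc k m = begin
  iter k g (suc m)                                ≡⟨ length-applyUpTo x _ ⟨
  length (pre (iter k g (suc m)))                 ≡⟨ cong length (pre-iter-g-suc k m) ⟩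
  length (pre (iter k g m) ++ iter k Φ [ x m ])   ≡⟨ length-++ (pre (iter k g m)) ⟩
  length (pre (iter k g m)) + length (iter k Φ [ x m ]) ≡⟨ cong (_+ length (iter k Φ [ x m ])) (length-applyUpTo x (iter k g m)) ⟩
  iter k g m + length (iter k Φ [ x m ])          ∎
  where open ≡-Reasoning

Q-iter-g-suc : ∀ k m → Q (iter k g (suc m)) ≡ Q (iter k g m) + S (iter k Φ [ x m ])
Q-iter-g-suc k m = trans (cong S (pre-iter-g-suc k m)) (S-++ (pre (iter k g m)) (iter k Φ [ x m ]))

block : ∀ k m → applyUpTo (λ j → x (iter k g m + j)) (length (iter k Φ [ x m ])) ≡ iter k Φ [ x m ]
block k m = ++-cancelˡ (pre (iter k g m)) _ _ (begin
  pre (iter k g m) ++ applyUpTo (λ j → x (iter k g m + j)) (length (iter k Φ [ x m ])) ≡⟨ applyUpTo-+ x (iter k g m) (length (iter k Φ [ x m ])) ⟨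
  pre (iter k g m + length (iter k Φ [ x m ]))    ≡⟨ cong pre (iter-g-suc k m) ⟨
  pre (iter k g (suc m))                          ≡⟨ pre-iter-g-suc k m ⟩
  pre (iter k g m) ++ iter k Φ [ x m ]            ∎)
  where open ≡-Reasoning

x-in-block : ∀ k m {j} → j < length (iter k Φ [ x m ]) → x (iter k g m + j) ≡ nthD 𝟎 (iter k Φ [ x m ]) j
x-in-block k m j<B = trans (sym (nthD-applyUpTo 𝟎 (λ j → x (iter k g m + j)) j<B)) (cong (λ w → nthD 𝟎 w _) (block k m))

block-of-𝟎 : ∀ k m → x m ≡ 𝟎 → applyUpTo (λ j → x (iter k g m + j)) (iter k g 1) ≡ pre (iter k g 1)
block-of-𝟎 k m x≡𝟎 = begin
  applyUpTo (λ j → x (iter k g m + j)) (iter k g 1)                 ≡⟨ cong (applyUpTo _) (length-applyUpTo x _) ⟨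
  applyUpTo (λ j → x (iter k g m + j)) (length (pre (iter k g 1)))  ≡⟨ subst (λ w → applyUpTo (λ j → x (iter k g m + j)) (length w) ≡ w) prefix (block k m) ⟩
  pre (iter k g 1)                                                  ∎
  where
  open ≡-Reasoning
  prefix : iter k Φ [ x m ] ≡ pre (iter k g 1)
  prefix = trans (cong (λ c → iter k Φ [ c ]) x≡𝟎) (fibPrefix≡pre k)

flip : Bin → Bin
flip 𝟎 = 𝟏
flip 𝟏 = 𝟎

last-letter : ℕ → Bin → Bin
last-letter zero    c = c
last-letter (suc k) c = flip (last-letter k c)

Φ-∷ʳ : ∀ w ℓ → Σ (List Bin) λ w′ → Φ (w ++ [ ℓ ]) ≡ w′ ++ [ flip ℓ ]
Φ-∷ʳ w 𝟎 = Φ w ++ [ 𝟎 ] , trans (concatMap-++ φ w [ 𝟎 ]) (sym (++-assoc (Φ w) [ 𝟎 ] [ 𝟏 ]))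
Φ-∷ʳ w 𝟏 = Φ w , concatMap-++ φ w [ 𝟏 ]

iter-Φ-∷ʳ : ∀ k c → Σ (List Bin) λ w → iter k Φ [ c ] ≡ w ++ [ last-letter k c ]
iter-Φ-∷ʳ zero    c = [] , refl
iter-Φ-∷ʳ (suc k) c with iter-Φ-∷ʳ k c
... | w , eq with Φ-∷ʳ w (last-letter k c)
...   | w′ , eq′ = w′ , trans (cong Φ eq) eq′

last-letter-flip : ∀ k c → last-letter k (flip c) ≡ flip (last-letter k c)
last-letter-flip zero    c = refl
last-letter-flip (suc k) c = cong flip (last-letter-flip k c)

letter-before-block-of-𝟎 : ∀ L m → x (suc m) ≡ 𝟎 →
  Σ ℕ λ i → applyUpTo (λ j → x (i + j)) (suc L) ≡ last-letter L (x m) ∷ pre L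
letter-before-block-of-𝟎 L m x≡𝟎 with iter-Φ-∷ʳ L (x m)
... | w , eq = i , cong₂ _∷_ x-i (applyUpTo-cong L x-after-i)
  where
  i = iter L g m + length w
  1+i≡ : suc i ≡ iter L g (suc m)
  1+i≡ = sym (begin
    iter L g (suc m)                          ≡⟨ iter-g-suc L m ⟩
    iter L g m + length (iter L Φ [ x m ])    ≡⟨ cong (λ v → iter L g m + length v) eq ⟩
    iter L g m + length (w ++ [ last-letter L (x m) ]) ≡⟨ cong (iter L g m +_) (length-++ w) ⟩
    iter L g m + (length w + 1)               ≡⟨ cong (iter L g m +_) (+-comm (length w) 1) ⟩
    iter L g m + suc (length w)               ≡⟨ +-suc (iter L g m) (length w) ⟩
    suc i                                     ∎)
    where open ≡-Reasoning
  x-i : x (i + 0) ≡ last-letter L (x m)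
  x-i = begin
    x (i + 0)                                     ≡⟨ cong x (+-identityʳ i) ⟩
    x i                                           ≡⟨ x-in-block L m w<B ⟩
    nthD 𝟎 (iter L Φ [ x m ]) (length w)          ≡⟨ cong (λ v → nthD 𝟎 v (length w)) eq ⟩
    nthD 𝟎 (w ++ [ last-letter L (x m) ]) (length w) ≡⟨ nthD-∷ʳ 𝟎 w _ ⟩
    last-letter L (x m)                           ∎
    where
    open ≡-Reasoning
    w<B : length w < length (iter L Φ [ x m ])
    w<B = subst (length w <_) (sym (trans (cong length eq) (length-++ w))) (m<m+n (length w) (s≤s z≤n))
  x-after-i : ∀ {j} → j < L → x (i + suc j) ≡ x j
  x-after-i {j} j<L = begin
    x (i + suc j)               ≡⟨ cong x (trans (+-suc i j) (cong (_+ j) 1+i≡)) ⟩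
    x (iter L g (suc m) + j)    ≡⟨ applyUpTo-injective (block-of-𝟎 L (suc m) x≡𝟎) (<-≤-trans j<L (≤-trans (n≤1+n L) (iter-g-grows L))) ⟩
    x j                         ∎
    where open ≡-Reasoning

letter-or-flip : ∀ c ℓ → c ≡ ℓ ⊎ c ≡ flip ℓ
letter-or-flip 𝟎 𝟎 = inj₁ refl
letter-or-flip 𝟎 𝟏 = inj₂ refl
letter-or-flip 𝟏 𝟎 = inj₂ refl
letter-or-flip 𝟏 𝟏 = inj₁ refl

-- φᴸ(x 1) and φᴸ(x 2) end in different letters, and each is followed by φᴸ(0), which begins with x[0..L).
prefix-extensions : ∀ L c → Σ ℕ λ i → applyUpTo (λ j → x (i + j)) (suc L) ≡ c ∷ pre L
prefix-extensions L c with letter-or-flip c (last-letter L 𝟎)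
... | inj₁ c≡ℓ with letter-before-block-of-𝟎 L 2 x-3
...   | i , occ = i , trans occ (cong (_∷ pre L) (trans (cong (last-letter L) x-2) (sym c≡ℓ)))
prefix-extensions L c | inj₂ c≡flipℓ with letter-before-block-of-𝟎 L 1 x-2
...   | i , occ = i , trans occ (cong (_∷ pre L) (trans (cong (last-letter L) x-1) (trans (last-letter-flip L 𝟎) (sym c≡flipℓ))))

S-attained : ∀ L c → InImageS (Q L + S [ c ])
S-attained L c with prefix-extensions L c
... | i , occ = i , L , trans (cong S (trans (factor≡ i (suc L)) occ)) (trans (S-++ [ c ] (pre L)) (+-comm (S [ c ]) (Q L)))

Q-attained : ∀ n → InImageS (Q (suc n))
Q-attained n = 0 , n , cong S (factor≡ 0 (suc n))

θ : AB → List Bin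
θ a = 𝟏 ∷ 𝟎 ∷ []
θ b = [ 𝟎 ]

θ-h : ∀ w → 𝟎 ∷ concatMap θ (concatMap h w) ≡ Φ (Φ (concatMap θ w)) ++ [ 𝟎 ]
θ-h []      = refl
θ-h (a ∷ w) = cong (λ v → 𝟎 ∷ 𝟏 ∷ 𝟎 ∷ 𝟏 ∷ 𝟎 ∷ v) (θ-h w)
θ-h (b ∷ w) = cong (λ v → 𝟎 ∷ 𝟏 ∷ 𝟎 ∷ v) (θ-h w)

θ-hPrefix : ∀ k → concatMap θ (hPrefix k) ++ [ 𝟏 ] ≡ 𝟏 ∷ pre (iter k (g ∘ g) 2)
θ-hPrefix zero    = cong₂ (λ c c′ → 𝟏 ∷ c ∷ c′ ∷ []) (sym x-0) (sym x-1)
θ-hPrefix (suc k) = ∷-injectiveʳ (begin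
  𝟎 ∷ concatMap θ (hPrefix (suc k)) ++ [ 𝟏 ]       ≡⟨ cong (_++ [ 𝟏 ]) (θ-h (hPrefix k)) ⟩
  (Φ (Φ T) ++ [ 𝟎 ]) ++ [ 𝟏 ]                      ≡⟨ ++-assoc (Φ (Φ T)) [ 𝟎 ] [ 𝟏 ] ⟩
  Φ (Φ T) ++ Φ (Φ [ 𝟏 ])                           ≡⟨ iter-concatMap-++ φ 2 T [ 𝟏 ] ⟨
  Φ (Φ (T ++ [ 𝟏 ]))                               ≡⟨ cong (Φ ∘ Φ) (θ-hPrefix k) ⟩
  𝟎 ∷ 𝟏 ∷ Φ (Φ (pre M))                            ≡⟨ cong (λ v → 𝟎 ∷ 𝟏 ∷ v) (Φ^k-pre 2 M) ⟩
  𝟎 ∷ 𝟏 ∷ pre (g (g M))                            ∎)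
  where
  open ≡-Reasoning
  T = concatMap θ (hPrefix k)
  M = iter k (g ∘ g) 2

ρ : Bin → ℕ
ρ c = S (iter 3 Φ [ c ])

δ-via-θ : ∀ w → concatMap δ w ++ [ 7 ] ≡ map ρ (concatMap θ w ++ [ 𝟏 ])
δ-via-θ []      = refl
δ-via-θ (a ∷ w) = cong (λ v → 7 ∷ 11 ∷ v) (δ-via-θ w)
δ-via-θ (b ∷ w) = cong (11 ∷_) (δ-via-θ w)

iter-g∘g-grows : ∀ k → 2 + k ≤ iter k (g ∘ g) 2
iter-g∘g-grows zero    = ≤-refl
iter-g∘g-grows (suc k) with iter k (g ∘ g) 2 | iter-g∘g-grows k
... | suc M | 2+k≤M = ≤-trans (s≤s 2+k≤M) (≤-trans (g-grows M) (m≤g (g (suc M))))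

δxH-suc : ∀ n → δxH (suc n) ≡ ρ (x n)
δxH-suc n = begin
  nthD 0 (concatMap δ H) (suc n)                        ≡⟨ nthD-++ˡ 0 (concatMap δ H) [ 7 ] n<δH ⟨
  nthD 0 (concatMap δ H ++ [ 7 ]) (suc n)               ≡⟨ cong (λ v → nthD 0 v (suc n)) δH≡ ⟩
  nthD 0 (map ρ (pre M)) n                              ≡⟨ cong (λ v → nthD 0 v n) (map-applyUpTo x ρ M) ⟩
  nthD 0 (applyUpTo (ρ ∘ x) M) n                        ≡⟨ nthD-applyUpTo 0 (ρ ∘ x) (≤-trans (m≤n+m (suc n) 3) (iter-g∘g-grows (2 + n))) ⟩
  ρ (x n)                                               ∎
  where
  open ≡-Reasoning
  H = hPrefix (2 + n)
  M = iter (2 + n) (g ∘ g) 2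
  δH≡ : concatMap δ H ++ [ 7 ] ≡ 7 ∷ map ρ (pre M)
  δH≡ = trans (δ-via-θ H) (cong (map ρ) (θ-hPrefix (2 + n)))
  length-δH : length (concatMap δ H) ≡ M
  length-δH = suc-injective (begin
    suc (length (concatMap δ H))             ≡⟨ +-comm 1 _ ⟩
    length (concatMap δ H) + 1               ≡⟨ length-++ (concatMap δ H) ⟨
    length (concatMap δ H ++ [ 7 ])          ≡⟨ cong length δH≡ ⟩
    suc (length (map ρ (pre M)))             ≡⟨ cong suc (trans (length-map ρ (pre M)) (length-applyUpTo x M)) ⟩
    suc M                                    ∎)
  n<δH : suc n < length (concatMap δ H)
  n<δH = subst (suc n <_) (sym length-δH) (≤-trans (m≤n+m (2 + n) 2) (iter-g∘g-grows (2 + n)))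

C : ℕ → ℕ
C zero    = 2
C (suc n) = C n + δxH n

g³ : ℕ → ℕ
g³ = iter 3 g

C-suc : ∀ k → C (suc k) ≡ Q (g³ k) + 9
C-suc zero    = refl
C-suc (suc k) = begin
  C (suc k) + δxH (suc k)        ≡⟨ cong₂ _+_ (C-suc k) (δxH-suc k) ⟩
  Q (g³ k) + 9 + ρ (x k)         ≡⟨ +-assoc (Q (g³ k)) 9 (ρ (x k)) ⟩
  Q (g³ k) + (9 + ρ (x k))       ≡⟨ cong (Q (g³ k) +_) (+-comm 9 (ρ (x k))) ⟩
  Q (g³ k) + (ρ (x k) + 9)       ≡⟨ +-assoc (Q (g³ k)) (ρ (x k)) 9 ⟨
  Q (g³ k) + ρ (x k) + 9         ≡⟨ cong (_+ 9) (Q-iter-g-suc 3 k) ⟨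
  Q (g³ (suc k)) + 9             ∎
  where open ≡-Reasoning

x-2+g³ : ∀ k → x (2 + g³ k) ≡ 𝟎
x-2+g³ k = subst (λ n → x n ≡ 𝟎) (g-suc-𝟎 (x-g (g k))) (x-g (suc (g (g k))))

x-3+g³ : ∀ k → x (3 + g³ k) ≡ 𝟎
x-3+g³ k = subst (λ n → x n ≡ 𝟎) (trans (g-suc-𝟏 (x-suc-g (g k) (x-g k))) (cong suc (g-suc-𝟎 (x-g (g k)))))
                 (x-g (suc (suc (g (g k)))))

Q-3+g³ : ∀ k → Q (3 + g³ k) ≡ Q (g³ k) + 7
Q-3+g³ k = begin
  Q (3 + j)                                          ≡⟨ Q-suc (2 + j) ⟩
  Q (2 + j) + S [ x (2 + j) ]                        ≡⟨ cong₂ (λ y c → y + S [ c ]) (Q-suc (1 + j)) (x-2+g³ k) ⟩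
  Q (1 + j) + S [ x (1 + j) ] + 3                    ≡⟨ cong₂ (λ y c → y + S [ c ] + 3) (Q-suc j) (x-suc-g (g (g k)) (x-g (g k))) ⟩
  Q j + S [ x j ] + 1 + 3                            ≡⟨ cong (λ c → Q j + S [ c ] + 1 + 3) (x-g (g (g k))) ⟩
  Q j + 3 + 1 + 3                                    ≡⟨ trans (+-assoc (Q j + 3) 1 3) (+-assoc (Q j) 3 4) ⟩
  Q j + 7                                            ∎
  where
  open ≡-Reasoning
  j = g³ k

C-suc-after-00 : ∀ k → C (suc k) ≡ Q (3 + g³ k) + 2
C-suc-after-00 k = trans (C-suc k) (trans (sym (+-assoc (Q (g³ k)) 7 2)) (cong (_+ 2) (sym (Q-3+g³ k))))

S-letter-positive : ∀ c → 0 < S [ c ]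
S-letter-positive 𝟎 = s≤s z≤n
S-letter-positive 𝟏 = s≤s z≤n

S-letter≡1 : ∀ {c} → S [ c ] ≡ 1 → c ≡ 𝟏
S-letter≡1 {𝟏} _ = refl

Q-<-suc : ∀ n → Q n < Q (suc n)
Q-<-suc n = subst (Q n <_) (sym (Q-suc n)) (m<m+n (Q n) (S-letter-positive (x n)))

Q-<-mono : ∀ {u v} → u < v → Q u < Q v
Q-<-mono {u} {suc v} (s≤s u≤v) with m≤n⇒m<n∨m≡n u≤v
... | inj₁ u<v  = <-trans (Q-<-mono u<v) (Q-<-suc v)
... | inj₂ refl = Q-<-suc u

Q-≤-mono : ∀ {u v} → u ≤ v → Q u ≤ Q v
Q-≤-mono u≤v with m≤n⇒m<n∨m≡n u≤v
... | inj₁ u<v  = <⇒≤ (Q-<-mono u<v)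
... | inj₂ refl = ≤-refl

n≤Q : ∀ n → n ≤ Q n
n≤Q zero    = z≤n
n≤Q (suc n) = <-≤-trans (s≤s (n≤Q n)) (Q-<-suc n)

Q≡Q+1⇒ : ∀ u v → Q u ≡ Q v + 1 → u ≡ suc v × x v ≡ 𝟏
Q≡Q+1⇒ u v eq with <-cmp u (suc v)
... | tri< u<1+v _ _ = contradiction (≤-trans (≤-reflexive (sym eq)) (Q-≤-mono (≤-pred u<1+v))) (<⇒≱ (m<m+n (Q v) (s≤s z≤n)))
... | tri≈ _ refl _  = refl , S-letter≡1 (+-cancelˡ-≡ (Q v) _ _ (trans (sym (Q-suc v)) eq))
... | tri> _ _ 1+v<u = contradiction (≤-trans (Q-≤-mono 1+v<u) (≤-reflexive eq)) (<⇒≱ (begin-strict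
  Q v + 1          ≤⟨ subst (_≤ Q (suc v)) (+-comm 1 (Q v)) (Q-<-suc v) ⟩
  Q (suc v)        <⟨ Q-<-suc (suc v) ⟩
  Q (suc (suc v))  ∎))
  where open ≤-Reasoning

Q≢1 : ∀ L → Q L ≢ 1
Q≢1 zero    ()
Q≢1 (suc L) QL≡1 = contradiction (≤-trans (Q-≤-mono (s≤s z≤n)) (≤-reflexive QL≡1)) (<⇒≱ 1<Q1)
  where
  1<Q1 : 1 < Q 1
  1<Q1 = subst (1 <_) (sym (trans (Q-suc 0) (cong (λ c → S [ c ]) x-0))) (s≤s (s≤s z≤n))

𝟎-or-𝟏 : ∀ c → c ≡ 𝟎 ⊎ c ≡ 𝟏
𝟎-or-𝟏 𝟎 = inj₁ refl
𝟎-or-𝟏 𝟏 = inj₂ refl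

𝟎≢𝟏 : 𝟎 ≢ 𝟏
𝟎≢𝟏 ()

block-position : ∀ r → Σ ℕ λ m → r ≡ g m ⊎ (r ≡ suc (g m) × x m ≡ 𝟎)
block-position zero = 0 , inj₁ refl
block-position (suc r) with block-position r
... | m , inj₂ (r≡ , x≡𝟎) = suc m , inj₁ (trans (cong suc r≡) (sym (g-suc-𝟎 x≡𝟎)))
... | m , inj₁ r≡ with x m in x≡
...   | 𝟎 = m , inj₂ (cong suc r≡ , x≡)
...   | 𝟏 = suc m , inj₁ (trans (cong suc r≡) (sym (g-suc-𝟏 x≡)))

zero-position : ∀ {r} → x r ≡ 𝟎 → Σ ℕ λ m → r ≡ g m
zero-position {r} x≡𝟎 with block-position r
... | m , inj₁ r≡ = m , r≡
... | m , inj₂ (r≡ , xm≡𝟎) = contradiction (trans (sym x≡𝟎) (trans (cong x r≡) (x-suc-g m xm≡𝟎))) 𝟎≢𝟏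

one-position : ∀ {r} → x r ≡ 𝟏 → Σ ℕ λ m → r ≡ suc (g m) × x m ≡ 𝟎
one-position {r} x≡𝟏 with block-position r
... | m , inj₂ p = m , p
... | m , inj₁ r≡ = contradiction (trans (sym (x-g m)) (trans (cong x (sym r≡)) x≡𝟏)) 𝟎≢𝟏

00-position : ∀ {n} → x n ≡ 𝟎 → x (suc n) ≡ 𝟎 → Σ ℕ λ k → n ≡ 2 + g³ k
00-position {n} xn≡𝟎 x1+n≡𝟎 with zero-position x1+n≡𝟎
... | suc m , 1+n≡ with 𝟎-or-𝟏 (x m)
...   | inj₁ xm≡ = contradiction (trans (sym xn≡𝟎) (trans (cong x (suc-injective (trans 1+n≡ (g-suc-𝟎 xm≡)))) (x-suc-g m xm≡))) 𝟎≢𝟏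
...   | inj₂ xm≡ with one-position xm≡
...     | r , m≡ , xr≡𝟎 with zero-position xr≡𝟎
...       | k , r≡ = k , (begin
  n                     ≡⟨ suc-injective (trans 1+n≡ (g-suc-𝟏 xm≡)) ⟩
  g m                   ≡⟨ cong g m≡ ⟩
  g (suc (g r))         ≡⟨ g-suc-𝟎 (x-g r) ⟩
  2 + g (g r)           ≡⟨ cong (λ y → 2 + g (g y)) r≡ ⟩
  2 + g³ k              ∎)
  where open ≡-Reasoning

Q-bracket : ∀ N {m} → 0 < m → m ≤ Q N → Σ ℕ λ n → Q n < m × m ≤ Q (suc n)
Q-bracket zero    0<m m≤0 = contradiction m≤0 (<⇒≱ 0<m)
Q-bracket (suc N) {m} 0<m m≤Q1+N with m ≤? Q N
... | yes m≤QN = Q-bracket N 0<m m≤QN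
... | no  m≰QN = N , ≰⇒> m≰QN , m≤Q1+N

-- m lies in (Q n, Q (n + 1)]; as Q (n + 1) and Q n + 1 are attained, x n = 0 and m = Q n + 2.
gap≡Q+2 : ∀ m → 0 < m → ¬ InImageS m → Σ ℕ λ n → x n ≡ 𝟎 × m ≡ Q n + 2
gap≡Q+2 m 0<m m∉ with Q-bracket m 0<m (n≤Q m)
... | n , Qn<m , m≤Q1+n with m≤n⇒m<n∨m≡n m≤Q1+n
...   | inj₂ m≡Q1+n = contradiction (subst InImageS (sym m≡Q1+n) (Q-attained n)) m∉
...   | inj₁ m<Q1+n with 𝟎-or-𝟏 (x n)
...     | inj₂ xn≡𝟏 = contradiction (subst (m <_) (trans (Q-suc n) (cong (λ c → Q n + S [ c ]) xn≡𝟏)) m<Q1+n) (≤⇒≯ (subst (_≤ m) (+-comm 1 (Q n)) Qn<m))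
...     | inj₁ xn≡𝟎 with m≤n⇒m<n∨m≡n Qn<m
...       | inj₂ 1+Qn≡m = contradiction (subst InImageS (trans (+-comm (Q n) 1) 1+Qn≡m) (S-attained n 𝟏)) m∉
...       | inj₁ 1+Qn<m = n , xn≡𝟎 , ≤-antisym m≤Qn+2 (subst (_≤ m) (+-comm 2 (Q n)) 1+Qn<m)
  where
  m≤Qn+2 : m ≤ Q n + 2
  m≤Qn+2 = ≤-pred (subst (m <_) (trans (Q-suc n) (trans (cong (λ c → Q n + S [ c ]) xn≡𝟎) (+-suc (Q n) 2))) m<Q1+n)

-- With m = Q n + 2 and x n = 0: x (n − 1) = 1 would make m = Q (n − 1) + 3 attained, so x (n − 1) x n = 00.
gap-is-C : ∀ m → 0 < m → ¬ InImageS m → Σ ℕ λ k → C k ≡ m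
gap-is-C m 0<m m∉ with gap≡Q+2 m 0<m m∉
... | zero  , _ , m≡ = 0 , sym m≡
... | suc n , x1+n≡𝟎 , m≡ with 𝟎-or-𝟏 (x n)
...   | inj₂ xn≡𝟏 = contradiction (subst InImageS (sym (trans m≡ Q1+n+2≡)) (S-attained n 𝟎)) m∉
  where
  Q1+n+2≡ : Q (suc n) + 2 ≡ Q n + 3
  Q1+n+2≡ = trans (cong (_+ 2) (trans (Q-suc n) (cong (λ c → Q n + S [ c ]) xn≡𝟏))) (+-assoc (Q n) 1 2)
...   | inj₁ xn≡𝟎 with 00-position xn≡𝟎 x1+n≡𝟎
...     | k , n≡ = suc k , trans (C-suc-after-00 k) (trans (cong (λ y → Q (suc y) + 2) (sym n≡)) (sym m≡))

-- C (k + 1) = Q j + 2 with x (j − 1) x j = 00 for j = 3 + g³ k: Q L + 1 = Q j + 2 would force x j = 1,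
-- and Q L + 3 = Q j + 2 would force x (j − 1) = 1.
C-not-image : ∀ k → ¬ InImageS (C k)
C-not-image k (i , L , S≡C) with k | S-factor-values i L
... | zero  | inj₁ S≡ = Q≢1 L (+-cancelʳ-≡ 1 (Q L) 1 (trans (sym S≡) S≡C))
... | zero  | inj₂ S≡ = contradiction (trans (+-comm 3 (Q L)) (trans (sym S≡) S≡C)) λ ()
... | suc k | inj₁ S≡ = contradiction (trans (sym (x-3+g³ k)) (proj₂ (Q≡Q+1⇒ L (3 + g³ k) QL≡))) 𝟎≢𝟏
  where
  QL≡ : Q L ≡ Q (3 + g³ k) + 1
  QL≡ = +-cancelʳ-≡ 1 _ _ (trans (trans (sym S≡) S≡C) (trans (C-suc-after-00 k) (sym (+-assoc _ 1 1))))
... | suc k | inj₂ S≡ with Q≡Q+1⇒ (3 + g³ k) L Q3+j≡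
  where
  Q3+j≡ : Q (3 + g³ k) ≡ Q L + 1
  Q3+j≡ = +-cancelʳ-≡ 2 _ _ (trans (sym (C-suc-after-00 k)) (trans (sym S≡C) (trans S≡ (sym (+-assoc (Q L) 1 2)))))
...   | 3+j≡1+L , xL≡𝟏 = contradiction (trans (sym (x-2+g³ k)) (trans (cong x (suc-injective 3+j≡1+L)) xL≡𝟏)) 𝟎≢𝟏

C-≥2 : ∀ k → 2 ≤ C k
C-≥2 zero    = ≤-refl
C-≥2 (suc k) = ≤-trans (C-≥2 k) (m≤m+n (C k) (δxH k))

δxH-positive : ∀ n → 0 < δxH n
δxH-positive zero    = s≤s z≤n
δxH-positive (suc n) = subst (0 <_) (sym (δxH-suc n)) (ρ-positive (x n))
  where
  ρ-positive : ∀ c → 0 < ρ c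
  ρ-positive 𝟎 = s≤s z≤n
  ρ-positive 𝟏 = s≤s z≤n

theorem5 : Σ (ℕ → ℕ) λ C →
             ((n : ℕ) → C n < C (suc n))
           × ((m : ℕ) → ((1 ≤ m × ¬ InImageS m) ⇔ Σ ℕ λ n → C n ≡ m))
           × ((n : ℕ) → C (suc n) ∸ C n ≡ δxH n)
theorem5 = C , C-increasing , gaps , (λ n → m+n∸m≡n (C n) (δxH n))
  where
  C-increasing : (n : ℕ) → C n < C (suc n)
  C-increasing n = m<m+n (C n) (δxH-positive n)
  gaps : (m : ℕ) → ((1 ≤ m × ¬ InImageS m) ⇔ Σ ℕ λ n → C n ≡ m)
  gaps m = mk⇔ (λ (0<m , m∉) → gap-is-C m 0<m m∉)
               (λ { (k , refl) → ≤-trans (s≤s z≤n) (C-≥2 k) , C-not-image k })
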